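{- Let $\Sigma=\{a,b,\overline{a},\overline{b}\}$ and let $L=\{x\in\Sigma^*:\ |x|_a+|x|_b=|x|_{\overline{a}}+|x|_{\overline{b}}\}$. Then $L$ is not a Church-Rosser congruential language: there is no finite Church-Rosser Thue system $T$ over $\Sigma$ together with finitely many strings $u_1,\dots,u_n$ such that $L=[u_1]_T\cup\dots\cup[u_n]_T$.
   Context: $\Sigma$ is a four-letter alphabet whose letters are written $a,b,\overline{a},\overline{b}$. For $x\in\Sigma^*$ and a letter $e$, $|x|_e$ is the number of occurrences of $e$ in $x$. A (finite) Thue system $T$ over $\Sigma$ is a finite set of pairs $(u,w)$ of strings, written with $|u|\ge|w|$. One writes $x\leftrightarrow_T y$ if $x=tuv$, $y=twv$ with $(u,w)\in T$ or $(w,u)\in T$; $\overset{*}{\leftrightarrow}_T$ is its reflexive-transitive closure (a congruence), and $[x]_T$ is the congruence class of $x$. One writes $x\to_T y$ if $x\leftrightarrow_T y$ and $|x|>|y|$, and $\overset{*}{\to}_T$ for the reflexive-transitive closure. $T$ is Church-Rosser if whenever $x\overset{*}{\leftrightarrow}_T y$ there is $z$ with $x\overset{*}{\to}_T z$ and $y\overset{*}{\to}_T z$. A language is a Church-Rosser congruential language if it is a union of finitely many congruence classes of $\overset{*}{\leftrightarrow}_T$ for some finite Church-Rosser Thue system $T$. -}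

module Defs where

open import Data.Nat using (ℕ; _+_; _≤_; _>_)
open import Data.List using (List; []; _∷_; _++_; length)
open import Data.List.Membership.Propositional using (_∈_)
open import Data.List.Relation.Unary.All using (All)
open import Data.List.Relation.Unary.Any using (Any)
open import Data.Product using (_×_; _,_; ∃; Σ; proj₁; proj₂)
open import Data.Sum using (_⊎_)
open import Relation.Binary.PropositionalEquality using (_≡_)
open import Relation.Binary.Construct.Closure.ReflexiveTransitive using (Star)
open import Function.Bundles using (_⇔_)

data Letter : Set where
  a b a̅ b̅ : Letter

Word : Set
Word = List Letter

count : Letter → Word → ℕ
count a  [] = 0
count b  [] = 0
count a̅ [] = 0
count b̅ [] = 0
count a  (a  ∷ x) = 1 + count a x
count a  (_  ∷ x) = count a x
count b  (b  ∷ x) = 1 + count b x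
count b  (_  ∷ x) = count b x
count a̅ (a̅ ∷ x) = 1 + count a̅ x
count a̅ (_  ∷ x) = count a̅ x
count b̅ (b̅ ∷ x) = 1 + count b̅ x
count b̅ (_  ∷ x) = count b̅ x

L : Word → Set
L x = count a x + count b x ≡ count a̅ x + count b̅ x

Rule : Set
Rule = Word × Word

ThueSystem : Set
ThueSystem = List Rule

WellOriented : ThueSystem → Set
WellOriented T = All (λ r → length (proj₂ r) ≤ length (proj₁ r)) T

data Step (T : ThueSystem) : Word → Word → Set where
  step : ∀ t u w v → ((u , w) ∈ T ⊎ (w , u) ∈ T) →
         Step T (t ++ u ++ v) (t ++ w ++ v)

Congruent : ThueSystem → Word → Word → Set
Congruent T = Star (Step T)

data Reduce (T : ThueSystem) (x y : Word) : Set where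
  reduce : Step T x y → length x > length y → Reduce T x y

Reduces : ThueSystem → Word → Word → Set
Reduces T = Star (Reduce T)

ChurchRosser : ThueSystem → Set
ChurchRosser T = ∀ x y → Congruent T x y →
  ∃ λ z → Reduces T x z × Reduces T y z

IsUnionOfClasses : ThueSystem → List Word → (Word → Set) → Set
IsUnionOfClasses T us P = ∀ x → P x ⇔ Any (λ u → Congruent T x u) us

ChurchRosserCongruential : (Word → Set) → Set
ChurchRosserCongruential P =
  Σ ThueSystem λ T → WellOriented T × ChurchRosser T ×
    Σ (List Word) λ us → IsUnionOfClasses T us P

-- Suppose L were the union of the classes of u₁, …, uₙ for a Church–Rosser system T, and let
-- B = |u₁| + ⋯ + |uₙ|. The balanced word z = a^M ā^M is congruent to a word of length ≤ B.
-- For a positive word P (over {a, b}) and any of the n + 1 positive words x of length n, the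
-- word ā^{|P|+n} P x lies in L, so by pigeonhole two of them, for x ≠ x', are congruent; as
-- z P x = a^M ā^{M-|P|-n} · ā^{|P|+n} P x, so are z P x and z P x'. If z P ~ s, then s x and
-- s x' are distinct congruent words of equal length, and the Church–Rosser property reduces
-- them to a common, strictly shorter word. Each round lengthens P by n and gains 1 on |s|, so
-- after B + 1 rounds (M is chosen large enough) z P ~ s with |s| < |P| for a positive word P. But z P ā^{|P|} ∈ L, hence s ā^{|P|} ∈ L,
-- which forces |s| ≥ |P|.
module Submission where

open import Defs
open import Relation.Nullary using (¬_)

open import Data.Empty using (⊥-elim)
open import Data.Fin using (Fin; toℕ)
import Data.Fin as Fin
open import Data.Fin.Properties using (pigeonhole; toℕ<n; toℕ-injective) renaming (<⇒≢ to <⇒≢ᶠ)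
open import Data.List using (List; []; _∷_; _++_; length; replicate; lookup; map)
open import Data.List.Properties using (++-assoc; ++-identityʳ; ++-cancelˡ; length-++; length-replicate; ∷-injectiveʳ)
open import Data.List.Relation.Unary.All using (All; []; _∷_)
open import Data.List.Relation.Unary.Any using (index)
open import Data.List.Relation.Unary.Any.Properties using (lookup-index)
import Data.List.Relation.Unary.Any as Any
open import Data.Nat using (ℕ; zero; suc; _+_; _*_; _∸_; _≤_; _<_; s≤s⁻¹)
open import Data.Nat.ListAction using (sum)
open import Data.Nat.Properties
open import Algebra.Properties.CommutativeSemigroup +-commutativeSemigroup using (interchange; xy∙z≈xz∙y)
open import Data.Product using (_×_; _,_; ∃; ∃₂)
open import Data.Sum using (_⊎_; inj₁; inj₂)
open import Function.Base using (id; _∘_)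
open import Function.Bundles using (Equivalence)
open import Relation.Binary.Construct.Closure.ReflexiveTransitive using (ε; _◅_; _◅◅_; gmap; reverse)
open import Relation.Binary.PropositionalEquality

open Equivalence using (to; from)

private
  variable
    T : ThueSystem
    c : Letter
    x y : Word

pos neg : Word → ℕ
pos x = count a x + count b x
neg x = count a̅ x + count b̅ x

pos-weight neg-weight : Letter → ℕ
pos-weight a = 1
pos-weight b = 1
pos-weight _ = 0
neg-weight a̅ = 1
neg-weight b̅ = 1
neg-weight _ = 0

pos-∷ : ∀ c x → pos (c ∷ x) ≡ pos-weight c + pos x
pos-∷ a x = refl
pos-∷ b x = +-suc (count a x) (count b x)
pos-∷ a̅ x = refl
pos-∷ b̅ x = refl

neg-∷ : ∀ c x → neg (c ∷ x) ≡ neg-weight c + neg x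
neg-∷ a x = refl
neg-∷ b x = refl
neg-∷ a̅ x = refl
neg-∷ b̅ x = +-suc (count a̅ x) (count b̅ x)

pos-weight+neg-weight≡1 : ∀ c → pos-weight c + neg-weight c ≡ 1
pos-weight+neg-weight≡1 a = refl
pos-weight+neg-weight≡1 b = refl
pos-weight+neg-weight≡1 a̅ = refl
pos-weight+neg-weight≡1 b̅ = refl

module _ (f : Word → ℕ) (weight : Letter → ℕ)
         (f-∷ : ∀ c x → f (c ∷ x) ≡ weight c + f x) (f-[] : f [] ≡ 0) where

  additive-++ : ∀ x y → f (x ++ y) ≡ f x + f y
  additive-++ [] y = cong (_+ f y) (sym f-[])
  additive-++ (c ∷ x) y = begin
    f (c ∷ x ++ y)            ≡⟨ f-∷ c (x ++ y) ⟩
    weight c + f (x ++ y)     ≡⟨ cong (weight c +_) (additive-++ x y) ⟩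
    weight c + (f x + f y)    ≡⟨ +-assoc (weight c) (f x) (f y) ⟨
    (weight c + f x) + f y    ≡⟨ cong (_+ f y) (f-∷ c x) ⟨
    f (c ∷ x) + f y           ∎
    where open ≡-Reasoning

pos-++ : ∀ x y → pos (x ++ y) ≡ pos x + pos y
pos-++ = additive-++ pos pos-weight pos-∷ refl

neg-++ : ∀ x y → neg (x ++ y) ≡ neg x + neg y
neg-++ = additive-++ neg neg-weight neg-∷ refl

pos+neg≡length : ∀ x → pos x + neg x ≡ length x
pos+neg≡length [] = refl
pos+neg≡length (c ∷ x) = begin
  pos (c ∷ x) + neg (c ∷ x)                         ≡⟨ cong₂ _+_ (pos-∷ c x) (neg-∷ c x) ⟩
  (pos-weight c + pos x) + (neg-weight c + neg x)   ≡⟨ interchange (pos-weight c) (pos x) (neg-weight c) (neg x) ⟩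
  (pos-weight c + neg-weight c) + (pos x + neg x)   ≡⟨ cong₂ _+_ (pos-weight+neg-weight≡1 c) (pos+neg≡length x) ⟩
  suc (length x)                                    ∎
  where open ≡-Reasoning

data IsPositive : Letter → Set where
  a-positive : IsPositive a
  b-positive : IsPositive b

Positive : Word → Set
Positive = All IsPositive

Positive-++ : Positive x → Positive y → Positive (x ++ y)
Positive-++ [] py = py
Positive-++ (p ∷ px) py = p ∷ Positive-++ px py

Positive-replicate : ∀ m → IsPositive c → Positive (replicate m c)
Positive-replicate zero p = []
Positive-replicate (suc m) p = p ∷ Positive-replicate m p

neg-positive : Positive x → neg x ≡ 0
neg-positive [] = refl
neg-positive (a-positive ∷ px) = neg-positive px
neg-positive (b-positive ∷ px) = neg-positive px

pos-positive : Positive x → pos x ≡ length x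
pos-positive {x} px = begin
  pos x            ≡⟨ +-identityʳ (pos x) ⟨
  pos x + 0        ≡⟨ cong (pos x +_) (neg-positive px) ⟨
  pos x + neg x    ≡⟨ pos+neg≡length x ⟩
  length x         ∎
  where open ≡-Reasoning

pos-a̅ⁿ : ∀ m → pos (replicate m a̅) ≡ 0
pos-a̅ⁿ zero = refl
pos-a̅ⁿ (suc m) = pos-a̅ⁿ m

neg-a̅ⁿ : ∀ m → neg (replicate m a̅) ≡ m
neg-a̅ⁿ zero = refl
neg-a̅ⁿ (suc m) = cong suc (neg-a̅ⁿ m)

L-++ : L x → L y → L (x ++ y)
L-++ {x} {y} lx ly = begin
  pos (x ++ y)     ≡⟨ pos-++ x y ⟩
  pos x + pos y    ≡⟨ cong₂ _+_ lx ly ⟩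
  neg x + neg y    ≡⟨ neg-++ x y ⟨
  neg (x ++ y)     ∎
  where open ≡-Reasoning

L-positive-a̅ⁿ : Positive x → L (x ++ replicate (length x) a̅)
L-positive-a̅ⁿ {x} px = begin
  pos (x ++ replicate k a̅)             ≡⟨ pos-++ x _ ⟩
  pos x + pos (replicate k a̅)          ≡⟨ cong₂ _+_ (pos-positive px) (pos-a̅ⁿ k) ⟩
  k + 0                                ≡⟨ +-comm k 0 ⟩
  0 + k                                ≡⟨ cong₂ _+_ (neg-positive px) (neg-a̅ⁿ k) ⟨
  neg x + neg (replicate k a̅)          ≡⟨ neg-++ x _ ⟨
  neg (x ++ replicate k a̅)             ∎
  where open ≡-Reasoning
        k = length x

L-a̅ⁿ-positive : Positive x → L (replicate (length x) a̅ ++ x)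
L-a̅ⁿ-positive {x} px = begin
  pos (replicate k a̅ ++ x)         ≡⟨ pos-++ (replicate k a̅) x ⟩
  pos (replicate k a̅) + pos x      ≡⟨ +-comm (pos (replicate k a̅)) (pos x) ⟩
  pos x + pos (replicate k a̅)      ≡⟨ pos-++ x (replicate k a̅) ⟨
  pos (x ++ replicate k a̅)         ≡⟨ L-positive-a̅ⁿ px ⟩
  neg (x ++ replicate k a̅)         ≡⟨ neg-++ x (replicate k a̅) ⟩
  neg x + neg (replicate k a̅)      ≡⟨ +-comm (neg x) (neg (replicate k a̅)) ⟩
  neg (replicate k a̅) + neg x      ≡⟨ neg-++ (replicate k a̅) x ⟨
  neg (replicate k a̅ ++ x)         ∎
  where open ≡-Reasoning
        k = length x

L-++-a̅ⁿ⇒≤ : ∀ x m → L (x ++ replicate m a̅) → m ≤ length x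
L-++-a̅ⁿ⇒≤ x m lx = begin
  m                                ≤⟨ m≤n+m m (neg x) ⟩
  neg x + m                        ≡⟨ cong (neg x +_) (neg-a̅ⁿ m) ⟨
  neg x + neg (replicate m a̅)      ≡⟨ neg-++ x _ ⟨
  neg (x ++ replicate m a̅)         ≡⟨ lx ⟨
  pos (x ++ replicate m a̅)         ≡⟨ pos-++ x _ ⟩
  pos x + pos (replicate m a̅)      ≡⟨ cong (pos x +_) (pos-a̅ⁿ m) ⟩
  pos x + 0                        ≡⟨ +-identityʳ (pos x) ⟩
  pos x                            ≤⟨ m≤m+n (pos x) (neg x) ⟩
  pos x + neg x                    ≡⟨ pos+neg≡length x ⟩
  length x                         ∎
  where open ≤-Reasoning

replicate-++ : ∀ {A : Set} m k (e : A) xs →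
               replicate m e ++ replicate k e ++ xs ≡ replicate (m + k) e ++ xs
replicate-++ zero k e xs = refl
replicate-++ (suc m) k e xs = cong (e ∷_) (replicate-++ m k e xs)

replicate-∸-++ : ∀ {A : Set} {m k} (e : A) xs → k ≤ m →
                 replicate (m ∸ k) e ++ replicate k e ++ xs ≡ replicate m e ++ xs
replicate-∸-++ {m = m} {k} e xs k≤m =
  trans (replicate-++ (m ∸ k) k e xs) (cong (λ l → replicate l e ++ xs) (m∸n+n≡m k≤m))

length-lookup≤sum : ∀ {A : Set} (xss : List (List A)) i → length (lookup xss i) ≤ sum (map length xss)
length-lookup≤sum (xs ∷ xss) Fin.zero = m≤m+n (length xs) _
length-lookup≤sum (xs ∷ xss) (Fin.suc i) = ≤-trans (length-lookup≤sum xss i) (m≤n+m _ (length xs))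

aⁱbʲ-injective : ∀ i j {k l} → replicate i a ++ replicate k b ≡ replicate j a ++ replicate l b → i ≡ j
aⁱbʲ-injective zero zero eq = refl
aⁱbʲ-injective (suc i) (suc j) eq = cong suc (aⁱbʲ-injective i j (∷-injectiveʳ eq))
aⁱbʲ-injective zero (suc j) {zero} ()
aⁱbʲ-injective zero (suc j) {suc k} ()
aⁱbʲ-injective (suc i) zero {l = zero} ()
aⁱbʲ-injective (suc i) zero {l = suc l} ()

Step-sym : Step T x y → Step T y x
Step-sym (step t u w v (inj₁ r)) = step t w u v (inj₂ r)
Step-sym (step t u w v (inj₂ r)) = step t w u v (inj₁ r)

Congruent-sym : Congruent T x y → Congruent T y x
Congruent-sym = reverse Step-sym

Step-++ˡ : ∀ p → Step T x y → Step T (p ++ x) (p ++ y)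
Step-++ˡ {T} p (step t u w v r) =
  subst₂ (Step T) (++-assoc p t (u ++ v)) (++-assoc p t (w ++ v)) (step (p ++ t) u w v r)

Step-++ʳ : ∀ q → Step T x y → Step T (x ++ q) (y ++ q)
Step-++ʳ {T} q (step t u w v r) = subst₂ (Step T) (reassoc u) (reassoc w) (step t u w (v ++ q) r)
  where
  reassoc : ∀ u → t ++ u ++ v ++ q ≡ (t ++ u ++ v) ++ q
  reassoc u = trans (cong (t ++_) (sym (++-assoc u v q))) (sym (++-assoc t (u ++ v) q))

Congruent-++ˡ : ∀ p → Congruent T x y → Congruent T (p ++ x) (p ++ y)
Congruent-++ˡ p = gmap (p ++_) (Step-++ˡ p)

Congruent-++ʳ : ∀ q → Congruent T x y → Congruent T (x ++ q) (y ++ q)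
Congruent-++ʳ q = gmap (_++ q) (Step-++ʳ q)

Reduces⇒Congruent : Reduces T x y → Congruent T x y
Reduces⇒Congruent = gmap id (λ { (reduce s _) → s })

Reduces⇒≡⊎shorter : Reduces T x y → x ≡ y ⊎ length y < length x
Reduces⇒≡⊎shorter ε = inj₁ refl
Reduces⇒≡⊎shorter (reduce _ y<x ◅ rs) with Reduces⇒≡⊎shorter rs
... | inj₁ refl = inj₂ y<x
... | inj₂ z<y = inj₂ (<-trans z<y y<x)

ChurchRosser⇒shorter : ChurchRosser T → Congruent T x y → x ≢ y → length x ≡ length y →
                       ∃ λ w → Reduces T x w × length w < length x
ChurchRosser⇒shorter cr x~y x≢y |x|≡|y| with cr _ _ x~y
... | w , x→w , y→w with Reduces⇒≡⊎shorter x→w | Reduces⇒≡⊎shorter y→w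
...   | inj₂ w<x | _        = w , x→w , w<x
...   | inj₁ _   | inj₂ w<y = w , x→w , subst (length w <_) (sym |x|≡|y|) w<y
...   | inj₁ x≡w | inj₁ y≡w = ⊥-elim (x≢y (trans x≡w (sym y≡w)))

module UnionOfClasses {us : List Word} {P : Word → Set} (iso : IsUnionOfClasses T us P) where

  closed : P x → Congruent T x y → P y
  closed {x} {y} px x~y = from (iso y) (Any.map (Congruent-sym x~y ◅◅_) (to (iso x) px))

  class : P x → Fin (length us)
  class {x} px = index (to (iso x) px)

  member-of-class : (px : P x) → Congruent T x (lookup us (class px))
  member-of-class {x} px = lookup-index (to (iso x) px)

  pigeonhole-congruent : ∀ (W : Fin (suc (length us)) → Word) → (∀ j → P (W j)) →
                         ∃₂ λ i j → i ≢ j × Congruent T (W i) (W j)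
  pigeonhole-congruent W pW with pigeonhole ≤-refl (λ j → class (pW j))
  ... | i , j , i<j , same = i , j , <⇒≢ᶠ i<j ,
        (member-of-class (pW i) ◅◅ subst (λ k → Congruent T (lookup us k) (W j)) (sym same)
                                            (Congruent-sym (member-of-class (pW j))))

module Refutation (T : ThueSystem) (cr : ChurchRosser T) (us : List Word)
                  (iso : IsUnionOfClasses T us L) where

  open UnionOfClasses iso

  n B M : ℕ
  n = length us
  B = sum (map length us)
  M = suc B * n

  z : Word
  z = replicate M a ++ replicate M a̅

  L-z : L z
  L-z = subst (λ k → L (replicate M a ++ replicate k a̅)) (length-replicate M)
              (L-positive-a̅ⁿ (Positive-replicate M a-positive))

  z-short : ∃ λ u → Congruent T z u × length u ≤ B
  z-short = _ , member-of-class L-z , length-lookup≤sum us (class L-z)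

  a̅ᵏ-++⇒z-++ : ∀ {k x y} → k ≤ M → Congruent T (replicate k a̅ ++ x) (replicate k a̅ ++ y) →
         Congruent T (z ++ x) (z ++ y)
  a̅ᵏ-++⇒z-++ {k} {x} {y} k≤M x~y =
    subst₂ (Congruent T) (unfold x) (unfold y) (Congruent-++ˡ (replicate M a ++ replicate (M ∸ k) a̅) x~y)
    where
    unfold : ∀ x → (replicate M a ++ replicate (M ∸ k) a̅) ++ replicate k a̅ ++ x ≡ z ++ x
    unfold x = begin
      (replicate M a ++ replicate (M ∸ k) a̅) ++ replicate k a̅ ++ x
        ≡⟨ ++-assoc (replicate M a) _ _ ⟩
      replicate M a ++ replicate (M ∸ k) a̅ ++ replicate k a̅ ++ x
        ≡⟨ cong (replicate M a ++_) (replicate-∸-++ a̅ x k≤M) ⟩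
      replicate M a ++ replicate M a̅ ++ x
        ≡⟨ ++-assoc (replicate M a) _ x ⟨
      z ++ x ∎
      where open ≡-Reasoning

  block : Fin (suc n) → Word
  block j = replicate (toℕ j) a ++ replicate (n ∸ toℕ j) b

  Positive-block : ∀ j → Positive (block j)
  Positive-block j = Positive-++ (Positive-replicate (toℕ j) a-positive) (Positive-replicate (n ∸ toℕ j) b-positive)

  length-block : ∀ j → length (block j) ≡ n
  length-block j = begin
    length (block j)                                                   ≡⟨ length-++ (replicate (toℕ j) a) ⟩
    length (replicate (toℕ j) a) + length (replicate (n ∸ toℕ j) b)    ≡⟨ cong₂ _+_ (length-replicate (toℕ j)) (length-replicate (n ∸ toℕ j)) ⟩
    toℕ j + (n ∸ toℕ j)                                                ≡⟨ m+[n∸m]≡n (s≤s⁻¹ (toℕ<n j)) ⟩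
    n                                                                  ∎
    where open ≡-Reasoning

  ++-block-injective : ∀ s {i j} → s ++ block i ≡ s ++ block j → i ≡ j
  ++-block-injective s {i} {j} eq = toℕ-injective (aⁱbʲ-injective (toℕ i) (toℕ j) (++-cancelˡ s _ _ eq))

  block-collision : ∀ {P} → Positive P → length P + n ≤ M →
                    ∃₂ λ i j → i ≢ j × Congruent T (z ++ P ++ block i) (z ++ P ++ block j)
  block-collision {P} pP k≤M = lift (pigeonhole-congruent W L-W)
    where
    W : Fin (suc n) → Word
    W j = replicate (length P + n) a̅ ++ P ++ block j
    L-W : ∀ j → L (W j)
    L-W j = subst (λ k → L (replicate k a̅ ++ P ++ block j))
                  (trans (length-++ P) (cong (length P +_) (length-block j)))
                  (L-a̅ⁿ-positive (Positive-++ pP (Positive-block j)))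
    lift : (∃₂ λ i j → i ≢ j × Congruent T (W i) (W j)) →
           ∃₂ λ i j → i ≢ j × Congruent T (z ++ P ++ block i) (z ++ P ++ block j)
    lift (i , j , i≢j , Wi~Wj) = i , j , i≢j , a̅ᵏ-++⇒z-++ k≤M Wi~Wj

  record Descent (i : ℕ) : Set where
    field
      prefix reduct : Word
      positive : Positive prefix
      length-prefix : length prefix ≡ i * n
      congruent : Congruent T (z ++ prefix) reduct
      short : length reduct + i ≤ B + length prefix

  module _ {i} (D : Descent i) where
    open Descent D

    reduct-++-block : ∀ j → Congruent T (z ++ prefix ++ block j) (reduct ++ block j)
    reduct-++-block j = subst (λ x → Congruent T x (reduct ++ block j)) (++-assoc z prefix (block j))
                              (Congruent-++ʳ (block j) congruent)

    length-reduct-++-block : ∀ j → length (reduct ++ block j) ≡ length reduct + n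
    length-reduct-++-block j = trans (length-++ reduct) (cong (length reduct +_) (length-block j))

    length-prefix-++-block : ∀ j → length (prefix ++ block j) ≡ length prefix + n
    length-prefix-++-block j = trans (length-++ prefix) (cong (length prefix +_) (length-block j))

    short-++-block : ∀ {ℓ} j → ℓ < length reduct + n → ℓ + suc i ≤ B + length (prefix ++ block j)
    short-++-block {ℓ} j ℓ< = begin
      ℓ + suc i                     ≡⟨ +-suc ℓ i ⟩
      suc ℓ + i                     ≤⟨ +-monoˡ-≤ i ℓ< ⟩
      (length reduct + n) + i       ≡⟨ xy∙z≈xz∙y (length reduct) n i ⟩
      (length reduct + i) + n       ≤⟨ +-monoˡ-≤ n short ⟩
      (B + length prefix) + n       ≡⟨ +-assoc B (length prefix) n ⟩
      B + (length prefix + n)       ≡⟨ cong (B +_) (length-prefix-++-block j) ⟨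
      B + length (prefix ++ block j) ∎
      where open ≤-Reasoning

    collision⇒shorter : ∀ {j₁ j₂} → j₁ ≢ j₂ → Congruent T (z ++ prefix ++ block j₁) (z ++ prefix ++ block j₂) →
                        ∃ λ w → Congruent T (z ++ prefix ++ block j₁) w × length w < length reduct + n
    collision⇒shorter {j₁} {j₂} j₁≢j₂ collide =
      let w , r , w<  = ChurchRosser⇒shorter cr
                          (Congruent-sym (reduct-++-block j₁) ◅◅ collide ◅◅ reduct-++-block j₂)
                          (j₁≢j₂ ∘ ++-block-injective reduct)
                          (trans (length-reduct-++-block j₁) (sym (length-reduct-++-block j₂)))
      in w , reduct-++-block j₁ ◅◅ Reduces⇒Congruent r , subst (length w <_) (length-reduct-++-block j₁) w<

  descent-step : ∀ {i} → suc i * n ≤ M → Descent i → Descent (suc i)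
  descent-step {i} h D =
    let j₁ , j₂ , j₁≢j₂ , collide = block-collision positive room
        w , zP~w , w< = collision⇒shorter D j₁≢j₂ collide
    in record
      { prefix = prefix ++ block j₁
      ; reduct = w
      ; positive = Positive-++ positive (Positive-block j₁)
      ; length-prefix = trans (length-prefix-++-block D j₁)
                              (trans (cong (_+ n) length-prefix) (+-comm (i * n) n))
      ; congruent = zP~w
      ; short = short-++-block D j₁ w<
      }
    where
    open Descent D
    room : length prefix + n ≤ M
    room = subst (_≤ M) (trans (+-comm n (i * n)) (cong (_+ n) (sym length-prefix))) h

  descent : ∀ i → i * n ≤ M → Descent i
  descent zero _ =
    let u , z~u , |u|≤B = z-short
    in record
      { prefix = []
      ; reduct = u
      ; positive = []
      ; length-prefix = refl
      ; congruent = subst (λ x → Congruent T x u) (sym (++-identityʳ z)) z~u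
      ; short = +-monoˡ-≤ 0 |u|≤B
      }
  descent (suc i) h = descent-step h (descent i (≤-trans (m≤n+m (i * n) n) h))

  no-long-descent : ¬ Descent (suc B)
  no-long-descent D = <-irrefl refl (+-cancelˡ-≤ (length reduct) (suc B) B (begin
    length reduct + suc B   ≤⟨ short ⟩
    B + length prefix       ≤⟨ +-monoʳ-≤ B prefix≤reduct ⟩
    B + length reduct       ≡⟨ +-comm B (length reduct) ⟩
    length reduct + B       ∎))
    where
    open Descent D
    open ≤-Reasoning
    L-reduct-++-a̅ⁿ : L (reduct ++ replicate (length prefix) a̅)
    L-reduct-++-a̅ⁿ = closed
      (subst L (sym (++-assoc z prefix _))
             (L-++ {z} {prefix ++ replicate (length prefix) a̅} L-z (L-positive-a̅ⁿ positive)))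
      (Congruent-++ʳ (replicate (length prefix) a̅) congruent)
    prefix≤reduct : length prefix ≤ length reduct
    prefix≤reduct = L-++-a̅ⁿ⇒≤ reduct (length prefix) L-reduct-++-a̅ⁿ

mainTheorem1 : ¬ ChurchRosserCongruential L
mainTheorem1 (T , _ , cr , us , iso) = no-long-descent (descent (suc B) ≤-refl)
  where open Refutation T cr us iso
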